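{- For all odd $n \geq 3$, $\mathsf{DL}(L_{3,n}) = r(L_{3,n}) = (n+1)/2$.
   Context: $L_{m,n}$ is the $m\times n$ grid graph, i.e. the Cartesian product of a path on $m$ vertices and a path on $n$ vertices. For a finite connected graph $G=(V,E)$ with $|V|=N$ and graph distance $d$, a $k$-dispersed labelling is a bijection $\phi:\{1,\dots,N\}\to V$ with $d(\phi(i),\phi(i+1))\ge k$ for $1\le i\le N-1$; $\mathsf{DL}(G)$ is the maximum such $k$. $r(G)=\min_v\max_u d(v,u)$ is the radius. -}

module Defs where

open import Data.Nat using (ℕ; zero; suc; _+_; _*_; _≤_)
open import Data.Fin using (Fin; toℕ; inject₁) renaming (suc to fsuc)
open import Data.Product using (Σ; ∃; _×_; _,_)
open import Data.Sum using (_⊎_)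
open import Function.Bundles using (_⤖_; Bijection)
open import Relation.Binary.PropositionalEquality using (_≡_)

-- A finite (simple, undirected) graph: vertex type V, adjacency relation,
-- and the number N of vertices (|V| = N is witnessed by the bijections
-- Fin N ⤖ V used in labellings below).
record Graph : Set₁ where
  field
    V    : Set
    Adj  : V → V → Set
    size : ℕ
open Graph public

data Walk (G : Graph) : V G → V G → ℕ → Set where
  here : ∀ {u} → Walk G u u 0
  step : ∀ {u v w k} → Adj G u v → Walk G v w k → Walk G u w (suc k)

Dist : (G : Graph) → V G → V G → ℕ → Set
Dist G u v d = Walk G u v d × (∀ k → Walk G u v k → d ≤ k)

-- A k-dispersed labelling: a bijection φ from the labels {1..N}
-- (represented as Fin N, label i+1 ↔ index i) onto V with
-- d(φ(i), φ(i+1)) ≥ k for consecutive labels.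
DispersedLabelling : (G : Graph) → ℕ → Set
DispersedLabelling G k =
  Σ (Fin (size G) ⤖ V G) λ φ →
    ∀ (i : Fin (size G)) (j : Fin (size G)) → toℕ j ≡ suc (toℕ i) →
      ∀ d → Dist G (Bijection.to φ i) (Bijection.to φ j) d → k ≤ d

IsDL : Graph → ℕ → Set
IsDL G k = DispersedLabelling G k × (∀ k′ → DispersedLabelling G k′ → k′ ≤ k)

IsEcc : (G : Graph) → V G → ℕ → Set
IsEcc G v e = (∀ u d → Dist G v u d → d ≤ e) × (∃ λ u → Dist G v u e)

IsRadius : Graph → ℕ → Set
IsRadius G r = (∃ λ v → IsEcc G v r) × (∀ v e → IsEcc G v e → r ≤ e)

PathAdj : ∀ {m} → Fin m → Fin m → Set
PathAdj a b = (toℕ b ≡ suc (toℕ a)) ⊎ (toℕ a ≡ suc (toℕ b))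

L : ℕ → ℕ → Graph
L m n = record
  { V    = Fin m × Fin n
  ; Adj  = λ { (a , b) (a′ , b′) →
               (a ≡ a′ × PathAdj b b′) ⊎ (PathAdj a a′ × b ≡ b′) }
  ; size = m * n
  }

-- Write n = 2m + 1.  Every vertex of L₃,ₙ lies within m + 1 of the centre (1, m), while every
-- vertex has some vertex at distance at least m + 1, so the radius is m + 1.  The centre's label
-- has a neighbouring label, whose vertex is within m + 1 of the centre, so DL ≤ m + 1.  Conversely,
-- label the vertices in three blocks p = 0, 1, 2, block p visiting
--   (p, 0), (p+1, m+1), (p, 1), (p+1, m+2), …, (p, m−1), (p+1, 2m), (p, m)   (rows mod 3);
-- consecutive vertices then always lie in different rows and in columns at least m apart.
module Submission where

open import Defs
open import Data.Empty using (⊥-elim)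
open import Data.Fin using (Fin; toℕ; fromℕ; fromℕ<; inject₁; combine; quotient; remainder)
  renaming (zero to fzero; suc to fsuc)
open import Data.Fin.Patterns using (0F; 1F; 2F)
open import Data.Fin.Properties
  using (toℕ-fromℕ; toℕ-fromℕ<; toℕ<n; toℕ-injective; toℕ-inject₁; toℕ-combine; combine-remQuot; *↔×)
open import Data.Nat using (ℕ; zero; suc; _+_; _*_; _∸_; _≤_; _<_; z≤n; s≤s; ∣_-_∣)
open import Data.Nat.DivMod using (_/_; _%_; m≡m%n+[m/n]*n; m*n/n≡m)
open import Data.Nat.Properties
open import Data.Product using (∃; _×_; _,_; proj₁; proj₂)
open import Data.Sum using (_⊎_; inj₁; inj₂)
open import Function.Bundles using (_↔_; Inverse; Bijection; mk↔ₛ′)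
open import Function.Construct.Composition using (_↔-∘_)
open import Function.Construct.Identity using (↔-id)
open import Function.Properties.Inverse using (↔⇒⤖)
open import Relation.Binary.PropositionalEquality

-- Walks and distances

AdjSymmetric : Graph → Set
AdjSymmetric G = ∀ {u v} → Adj G u v → Adj G v u

module _ {G : Graph} where

  _++ʷ_ : ∀ {u v w k l} → Walk G u v k → Walk G v w l → Walk G u w (k + l)
  here     ++ʷ q = q
  step a p ++ʷ q = step a (p ++ʷ q)

  snocʷ : ∀ {u v w k} → Walk G u v k → Adj G v w → Walk G u w (suc k)
  snocʷ here       a = step a here
  snocʷ (step b p) a = step b (snocʷ p a)

  reverseʷ : AdjSymmetric G → ∀ {u v k} → Walk G u v k → Walk G v u k
  reverseʷ sym-adj here       = here
  reverseʷ sym-adj (step a p) = snocʷ (reverseʷ sym-adj p) (sym-adj a)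

  Dist-unique : ∀ {u v d d′} → Dist G u v d → Dist G u v d′ → d ≡ d′
  Dist-unique (p , p-min) (q , q-min) = ≤-antisym (p-min _ q) (q-min _ p)

  Dist-sym : AdjSymmetric G → ∀ {u v d} → Dist G u v d → Dist G v u d
  Dist-sym sym-adj (p , p-min) =
    reverseʷ sym-adj p , λ k q → p-min k (reverseʷ sym-adj q)

mapʷ : ∀ {G H : Graph} (f : V G → V H) → (∀ {u v} → Adj G u v → Adj H (f u) (f v)) →
       ∀ {u v k} → Walk G u v k → Walk H (f u) (f v) k
mapʷ f f-adj here       = here
mapʷ f f-adj (step a p) = step (f-adj a) (mapʷ f f-adj p)

neighbour : ∀ {N} → 1 < N → (i : Fin N) →
            ∃ λ (j : Fin N) → toℕ j ≡ suc (toℕ i) ⊎ toℕ i ≡ suc (toℕ j)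
neighbour {suc zero}    (s≤s ()) fzero
neighbour {suc (suc _)} _        fzero    = 1F , inj₁ refl
neighbour               _        (fsuc i) = inject₁ i , inj₂ (cong suc (sym (toℕ-inject₁ i)))

dispersion≤eccentricity : ∀ {G k v e} → AdjSymmetric G → (∀ u w → ∃ (Dist G u w)) →
                          1 < size G → (∀ u d → Dist G v u d → d ≤ e) →
                          DispersedLabelling G k → k ≤ e
dispersion≤eccentricity {G} {v = v} sym-adj connected 1<N v-ecc (φ , dispersed)
  with (i , φi≡v) ← Bijection.strictlySurjective φ v | neighbour 1<N i
... | j , inj₁ j≡1+i =
  let d , dist = connected (φ.to i) (φ.to j) in
  ≤-trans (dispersed i j j≡1+i d dist) (v-ecc (φ.to j) d (subst (λ x → Dist G x (φ.to j) d) φi≡v dist))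
  where module φ = Bijection φ
... | j , inj₂ i≡1+j =
  let d , dist = connected (φ.to j) (φ.to i) in
  ≤-trans (dispersed j i i≡1+j d dist)
          (v-ecc (φ.to j) d (subst (λ x → Dist G x (φ.to j) d) φi≡v (Dist-sym sym-adj dist)))
  where module φ = Bijection φ

-- Distances in grids

PathGraph : ℕ → Graph
PathGraph B = record { V = Fin B ; Adj = PathAdj ; size = B }

PathAdj-sym : ∀ {B} → AdjSymmetric (PathGraph B)
PathAdj-sym (inj₁ e) = inj₂ e
PathAdj-sym (inj₂ e) = inj₁ e

fsuc-PathAdj : ∀ {B} {a b : Fin B} → PathAdj a b → PathAdj (fsuc a) (fsuc b)
fsuc-PathAdj (inj₁ e) = inj₁ (cong suc e)
fsuc-PathAdj (inj₂ e) = inj₂ (cong suc e)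

PathAdj⇒∣-∣≡1 : ∀ {B} {a b : Fin B} → PathAdj a b → ∣ toℕ a - toℕ b ∣ ≡ 1
PathAdj⇒∣-∣≡1 {a = a} (inj₁ e) rewrite e = ∣n-1+n∣≡1 (toℕ a)
  where
  ∣n-1+n∣≡1 : ∀ n → ∣ n - suc n ∣ ≡ 1
  ∣n-1+n∣≡1 zero    = refl
  ∣n-1+n∣≡1 (suc n) = ∣n-1+n∣≡1 n
PathAdj⇒∣-∣≡1 {b = b} (inj₂ e) = trans (∣-∣-comm _ (toℕ b)) (PathAdj⇒∣-∣≡1 (inj₁ e))

path-step : ∀ {B} {a b : Fin B} → PathAdj a b → ∀ c → ∣ toℕ a - c ∣ ≤ suc ∣ toℕ b - c ∣
path-step {a = a} {b} p c = begin
  ∣ toℕ a - c ∣                     ≤⟨ ∣-∣-triangle (toℕ a) (toℕ b) c ⟩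
  ∣ toℕ a - toℕ b ∣ + ∣ toℕ b - c ∣  ≡⟨ cong (_+ ∣ toℕ b - c ∣) (PathAdj⇒∣-∣≡1 p) ⟩
  suc ∣ toℕ b - c ∣                 ∎
  where open ≤-Reasoning

path-walk-from-0 : ∀ {B} (j : Fin (suc B)) → Walk (PathGraph (suc B)) fzero j (toℕ j)
path-walk-from-0         fzero    = here
path-walk-from-0 {zero}  (fsuc ())
path-walk-from-0 {suc B} (fsuc j) = step (inj₁ refl) (mapʷ fsuc fsuc-PathAdj (path-walk-from-0 j))

path-walk : ∀ {B} (i j : Fin B) → Walk (PathGraph B) i j ∣ toℕ i - toℕ j ∣
path-walk fzero    j        = path-walk-from-0 j
path-walk (fsuc i) fzero    = reverseʷ PathAdj-sym (path-walk-from-0 (fsuc i))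
path-walk (fsuc i) (fsuc j) = mapʷ fsuc fsuc-PathAdj (path-walk i j)

module _ {A B : ℕ} where

  manhattan : Fin A × Fin B → Fin A × Fin B → ℕ
  manhattan (a , b) (c , d) = ∣ toℕ a - toℕ c ∣ + ∣ toℕ b - toℕ d ∣

  grid-Adj-sym : AdjSymmetric (L A B)
  grid-Adj-sym (inj₁ (e , p)) = inj₁ (sym e , PathAdj-sym p)
  grid-Adj-sym (inj₂ (p , e)) = inj₂ (PathAdj-sym p , sym e)

  grid-walk : ∀ u v → Walk (L A B) u v (manhattan u v)
  grid-walk (a , b) (c , d) =
    mapʷ (_, b) (λ p → inj₂ (p , refl)) (path-walk a c) ++ʷ
    mapʷ (c ,_) (λ p → inj₁ (refl , p)) (path-walk b d)

  manhattan-step : ∀ {u v} → Adj (L A B) u v → ∀ w → manhattan u w ≤ suc (manhattan v w)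
  manhattan-step {a , b} {_ , b′} (inj₁ (refl , p)) (c , d) = begin
    ∣ toℕ a - toℕ c ∣ + ∣ toℕ b - toℕ d ∣         ≤⟨ +-monoʳ-≤ ∣ toℕ a - toℕ c ∣ (path-step p (toℕ d)) ⟩
    ∣ toℕ a - toℕ c ∣ + suc ∣ toℕ b′ - toℕ d ∣    ≡⟨ +-suc ∣ toℕ a - toℕ c ∣ _ ⟩
    suc (∣ toℕ a - toℕ c ∣ + ∣ toℕ b′ - toℕ d ∣)  ∎
    where open ≤-Reasoning
  manhattan-step {a , b} {a′ , _} (inj₂ (p , refl)) (c , d) =
    +-monoˡ-≤ ∣ toℕ b - toℕ d ∣ (path-step p (toℕ c))

  manhattan≤length : ∀ {u v k} → Walk (L A B) u v k → manhattan u v ≤ k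
  manhattan≤length {a , b} here = ≤-reflexive (cong₂ _+_ (∣n-n∣≡0 (toℕ a)) (∣n-n∣≡0 (toℕ b)))
  manhattan≤length {v = w} (step a p) = ≤-trans (manhattan-step a w) (s≤s (manhattan≤length p))

  grid-dist : ∀ u v → Dist (L A B) u v (manhattan u v)
  grid-dist u v = grid-walk u v , λ _ → manhattan≤length

  Dist⇒≡manhattan : ∀ {u v d} → Dist (L A B) u v d → d ≡ manhattan u v
  Dist⇒≡manhattan {u} {v} dist = Dist-unique dist (grid-dist u v)

-- The radius of an odd-by-odd grid

∣m-n∣≤m : ∀ {m n} → n ≤ m + m → ∣ m - n ∣ ≤ m
∣m-n∣≤m {m} {n} n≤2m with ≤-total n m
... | inj₁ n≤m rewrite m≤n⇒∣n-m∣≡n∸m n≤m = m∸n≤m m n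
... | inj₂ m≤n rewrite m≤n⇒∣m-n∣≡n∸m m≤n = begin
  n ∸ m      ≤⟨ ∸-monoˡ-≤ m n≤2m ⟩
  m + m ∸ m  ≡⟨ m+n∸m≡n m m ⟩
  m          ∎
  where open ≤-Reasoning

far-end : ∀ {m} (c : Fin (suc (m + m))) → ∃ λ c′ → m ≤ ∣ toℕ c - toℕ c′ ∣
far-end {m} c with ≤-total m (toℕ c)
... | inj₁ m≤c = fzero , subst (m ≤_) (sym (∣-∣-identityʳ (toℕ c))) m≤c
... | inj₂ c≤m = fromℕ (m + m) , subst (m ≤_) (sym ∣c-2m∣) (begin
  m          ≡⟨ m+n∸m≡n m m ⟨
  m + m ∸ m  ≤⟨ ∸-monoʳ-≤ (m + m) c≤m ⟩
  m + m ∸ toℕ c ∎)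
  where
  open ≤-Reasoning
  ∣c-2m∣ : ∣ toℕ c - toℕ (fromℕ (m + m)) ∣ ≡ m + m ∸ toℕ c
  ∣c-2m∣ rewrite toℕ-fromℕ (m + m) = m≤n⇒∣m-n∣≡n∸m (≤-trans c≤m (m≤m+n m m))

middle : ∀ m → Fin (suc (m + m))
middle m = fromℕ< (s≤s (m≤m+n m m))

toℕ-middle : ∀ m → toℕ (middle m) ≡ m
toℕ-middle m = toℕ-fromℕ< (s≤s (m≤m+n m m))

module _ {a m : ℕ} where

  Grid : Graph
  Grid = L (suc (a + a)) (suc (m + m))

  centre : V Grid
  centre = middle a , middle m

  centre-eccentricity : IsEcc Grid centre (a + m)
  centre-eccentricity = within , (0F , 0F) , subst (Dist Grid centre (0F , 0F)) corner (grid-dist _ _)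
    where
    within : ∀ u d → Dist Grid centre u d → d ≤ a + m
    within (r , c) d dist rewrite Dist⇒≡manhattan dist | toℕ-middle a | toℕ-middle m =
      +-mono-≤ (∣m-n∣≤m {a} (≤-pred (toℕ<n r))) (∣m-n∣≤m {m} (≤-pred (toℕ<n c)))
    corner : manhattan centre (0F , 0F) ≡ a + m
    corner rewrite toℕ-middle a | toℕ-middle m =
      cong₂ _+_ (∣-∣-identityʳ a) (∣-∣-identityʳ m)

  eccentricity≥ : ∀ v {e} → IsEcc Grid v e → a + m ≤ e
  eccentricity≥ (r , c) (within , _) with far-end {a} r | far-end {m} c
  ... | r′ , r-far | c′ , c-far = ≤-trans (+-mono-≤ r-far c-far) (within (r′ , c′) _ (grid-dist _ _))

  odd-grid-radius : IsRadius Grid (a + m)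
  odd-grid-radius = (centre , centre-eccentricity) , λ v e → eccentricity≥ v

-- The labelling of the 3-row grid

*+-unique : ∀ {n} p p′ {t t′} → t < n → t′ < n → p * n + t ≡ p′ * n + t′ → p ≡ p′ × t ≡ t′
*+-unique zero     zero      _   _    eq = refl , eq
*+-unique {n} zero (suc p′) {t} {t′} t<n _ eq =
  ⊥-elim (<⇒≱ t<n (subst (n ≤_) (trans (sym (+-assoc n (p′ * n) t′)) (sym eq)) (m≤m+n n (p′ * n + t′))))
*+-unique (suc p)  zero      t<n t′<n eq
  with p≡ , t≡ ← *+-unique zero (suc p) t′<n t<n (sym eq) = sym p≡ , sym t≡
*+-unique {n} (suc p) (suc p′) t<n t′<n eq
  with refl , t≡t′ ← *+-unique p p′ t<n t′<n
         (+-cancelˡ-≡ n _ _ (trans (sym (+-assoc n (p * n) _)) (trans eq (+-assoc n (p′ * n) _)))) =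
  refl , t≡t′

carry : ∀ {n p p′ t t′} → t < n → t′ < n → p′ * n + t′ ≡ suc (p * n + t) →
        (p′ ≡ p × t′ ≡ suc t) ⊎ (p′ ≡ suc p × t′ ≡ 0 × suc t ≡ n)
carry {n} {p} {p′} {t} {t′} t<n t′<n eq with m≤n⇒m<n∨m≡n t<n
... | inj₁ 1+t<n with p′≡p , t′≡1+t ← *+-unique p′ p t′<n 1+t<n (trans eq (sym (+-suc (p * n) t))) =
  inj₁ (p′≡p , t′≡1+t)
... | inj₂ refl
  with p′≡1+p , t′≡0 ← *+-unique p′ (suc p) t′<n (s≤s z≤n)
         (trans eq (trans (cong suc (+-comm (p * n) t)) (sym (+-identityʳ _)))) =
  inj₂ (p′≡1+p , t′≡0 , refl)

toℕ-remQuot : ∀ {k} n (i : Fin (k * n)) → toℕ i ≡ toℕ (quotient {k} n i) * n + toℕ (remainder {k} n i)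
toℕ-remQuot {k} n i = begin
  toℕ i              ≡⟨ cong toℕ (combine-remQuot {k} n i) ⟨
  toℕ (combine q r)  ≡⟨ toℕ-combine q r ⟩
  n * toℕ q + toℕ r  ≡⟨ cong (_+ toℕ r) (*-comm n (toℕ q)) ⟩
  toℕ q * n + toℕ r  ∎
  where
  open ≡-Reasoning
  q = quotient {k} n i
  r = remainder {k} n i

shear↔ : ∀ {R A B : Set} → (A → R ↔ R) → A ↔ B → (R × A) ↔ (R × B)
shear↔ {R} {A} {B} ρ σ = mk↔ₛ′ to from to∘from from∘to
  where
  module σ = Inverse σ
  to : R × A → R × B
  to (r , a) = Inverse.to (ρ a) r , σ.to a
  from : R × B → R × A
  from (r , b) = Inverse.from (ρ (σ.from b)) r , σ.from b
  to∘from : ∀ y → to (from y) ≡ y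
  to∘from (r , b) = cong₂ _,_ (Inverse.strictlyInverseˡ (ρ (σ.from b)) r) (σ.strictlyInverseˡ b)
  from∘to : ∀ x → from (to x) ≡ x
  from∘to (r , a) rewrite σ.strictlyInverseʳ a = cong (_, a) (Inverse.strictlyInverseʳ (ρ a) r)

Fin-restrict-↔ : ∀ {n} (f g : ℕ → ℕ) → (∀ {x} → x < n → f x < n) → (∀ {x} → x < n → g x < n) →
                 (∀ {x} → x < n → f (g x) ≡ x) → (∀ {x} → x < n → g (f x) ≡ x) → Fin n ↔ Fin n
Fin-restrict-↔ {n} f g f< g< f∘g g∘f =
  mk↔ₛ′ (restrict f f<) (restrict g g<) (inverse f g f< g< f∘g) (inverse g f g< f< g∘f)
  where
  restrict : (h : ℕ → ℕ) → (∀ {x} → x < n → h x < n) → Fin n → Fin n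
  restrict h h< x = fromℕ< (h< (toℕ<n x))
  inverse : ∀ h k (h< : ∀ {x} → x < n → h x < n) (k< : ∀ {x} → x < n → k x < n) →
            (∀ {x} → x < n → h (k x) ≡ x) → ∀ x → restrict h h< (restrict k k< x) ≡ x
  inverse h k h< k< h∘k x = toℕ-injective (begin
    toℕ (restrict h h< (restrict k k< x))  ≡⟨ toℕ-fromℕ< _ ⟩
    h (toℕ (restrict k k< x))             ≡⟨ cong h (toℕ-fromℕ< _) ⟩
    h (k (toℕ x))                         ≡⟨ h∘k (toℕ<n x) ⟩
    toℕ x                                 ∎)
    where open ≡-Reasoning

data ParityView : ℕ → Set where
  even : ∀ s → ParityView (s + s)
  odd  : ∀ s → ParityView (suc (s + s))

parityView : ∀ t → ParityView t
parityView zero = even zero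
parityView (suc t) with parityView t
... | even s = odd s
... | odd s  = subst ParityView (cong suc (+-suc s s)) (even (suc s))

double-cancel-≤ : ∀ {s m} → s + s ≤ m + m → s ≤ m
double-cancel-≤ le = ≮⇒≥ (λ m<s → <⇒≱ (+-mono-< m<s m<s) le)

double-cancel-< : ∀ {s m} → s + s < m + m → s < m
double-cancel-< lt = ≰⇒> (λ m≤s → <⇒≱ lt (+-mono-≤ m≤s m≤s))

rotate : Fin 3 → Fin 3
rotate 0F = 1F
rotate 1F = 2F
rotate 2F = 0F

rotate⁻¹ : Fin 3 → Fin 3
rotate⁻¹ 0F = 2F
rotate⁻¹ 1F = 0F
rotate⁻¹ 2F = 1F

rotate↔ : Fin 3 ↔ Fin 3
rotate↔ = mk↔ₛ′ rotate rotate⁻¹ (λ { 0F → refl ; 1F → refl ; 2F → refl })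
                                (λ { 0F → refl ; 1F → refl ; 2F → refl })

rotate-fixpoint-free : ∀ r → rotate r ≢ r
rotate-fixpoint-free 0F ()
rotate-fixpoint-free 1F ()
rotate-fixpoint-free 2F ()

rowShift : ℕ → Fin 3 ↔ Fin 3
rowShift zero          = ↔-id (Fin 3)
rowShift (suc zero)    = rotate↔
rowShift (suc (suc t)) = rowShift t

rowShift-step : ∀ t r → Inverse.to (rowShift t) r ≢ Inverse.to (rowShift (suc t)) r
rowShift-step zero          r = λ eq → rotate-fixpoint-free r (sym eq)
rowShift-step (suc zero)    r = rotate-fixpoint-free r
rowShift-step (suc (suc t)) r = rowShift-step t r

rowShift-even : ∀ s r → Inverse.to (rowShift (s + s)) r ≡ r
rowShift-even zero    r = refl
rowShift-even (suc s) r rewrite +-suc s s = rowShift-even s r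

zigzag : ℕ → ℕ → ℕ
zigzag m zero          = zero
zigzag m (suc zero)    = suc m
zigzag m (suc (suc t)) = suc (zigzag m t)

zigzag-even : ∀ m s → zigzag m (s + s) ≡ s
zigzag-even m zero    = refl
zigzag-even m (suc s) rewrite +-suc s s = cong suc (zigzag-even m s)

zigzag-odd : ∀ m s → zigzag m (suc (s + s)) ≡ suc (m + s)
zigzag-odd m zero    = cong suc (sym (+-identityʳ m))
zigzag-odd m (suc s) rewrite +-suc s s | +-suc m s = cong suc (zigzag-odd m s)

zigzag-step : ∀ m t → m ≤ ∣ zigzag m t - zigzag m (suc t) ∣
zigzag-step m zero          = n≤1+n m
zigzag-step m (suc zero)    = ≤-reflexive (sym (∣-∣-identityʳ m))
zigzag-step m (suc (suc t)) = zigzag-step m t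

unzigzag : ℕ → ℕ → ℕ
unzigzag m c with c ∸ m
... | zero  = c + c
... | suc s = suc (s + s)

n∸m≡1+s⇒n≡1+m+s : ∀ m {c s} → c ∸ m ≡ suc s → c ≡ suc (m + s)
n∸m≡1+s⇒n≡1+m+s zero    eq = eq
n∸m≡1+s⇒n≡1+m+s (suc m) {suc c} eq = cong suc (n∸m≡1+s⇒n≡1+m+s m eq)

1+m+s∸m≡1+s : ∀ m s → suc (m + s) ∸ m ≡ suc s
1+m+s∸m≡1+s m s = trans (cong (_∸ m) (sym (+-suc m s))) (m+n∸m≡n m (suc s))

module _ (m : ℕ) where

  zigzag< : ∀ {t} → t < suc (m + m) → zigzag m t < suc (m + m)
  zigzag< {t} t<n with parityView t
  ... | even s rewrite zigzag-even m s = ≤-<-trans (m≤m+n s s) t<n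
  ... | odd s  rewrite zigzag-odd m s  = s≤s (+-monoʳ-< m (double-cancel-< (≤-pred t<n)))

  unzigzag< : ∀ {c} → c < suc (m + m) → unzigzag m c < suc (m + m)
  unzigzag< {c} c<n with c ∸ m in eq
  ... | zero  = s≤s (+-mono-≤ c≤m c≤m)
    where
    c≤m : c ≤ m
    c≤m = m∸n≡0⇒m≤n eq
  ... | suc s rewrite n∸m≡1+s⇒n≡1+m+s m eq = s≤s (+-mono-< s<m s<m)
    where
    s<m : s < m
    s<m = +-cancelˡ-< m s m (≤-pred c<n)

  unzigzag-left : ∀ {c} → c ≤ m → unzigzag m c ≡ c + c
  unzigzag-left c≤m rewrite m≤n⇒m∸n≡0 c≤m = refl

  unzigzag-right : ∀ s → unzigzag m (suc (m + s)) ≡ suc (s + s)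
  unzigzag-right s rewrite 1+m+s∸m≡1+s m s = refl

  zigzag∘unzigzag : ∀ c → zigzag m (unzigzag m c) ≡ c
  zigzag∘unzigzag c with c ∸ m in eq
  ... | zero  = zigzag-even m c
  ... | suc s = trans (zigzag-odd m s) (sym (n∸m≡1+s⇒n≡1+m+s m eq))

  unzigzag∘zigzag : ∀ {t} → t < suc (m + m) → unzigzag m (zigzag m t) ≡ t
  unzigzag∘zigzag {t} t<n with parityView t
  ... | even s = trans (cong (unzigzag m) (zigzag-even m s)) (unzigzag-left (double-cancel-≤ (≤-pred t<n)))
  ... | odd s  = trans (cong (unzigzag m) (zigzag-odd m s)) (unzigzag-right s)

  zigzag↔ : Fin (suc (m + m)) ↔ Fin (suc (m + m))
  zigzag↔ = Fin-restrict-↔ (zigzag m) (unzigzag m) zigzag< unzigzag< (λ {c} _ → zigzag∘unzigzag c)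
                           unzigzag∘zigzag

apart⇒dispersed : ∀ {A B m} {r r′ : Fin A} {c c′ : Fin B} → r ≢ r′ → m ≤ ∣ toℕ c - toℕ c′ ∣ →
                  suc m ≤ manhattan (r , c) (r′ , c′)
apart⇒dispersed r≢r′ cols =
  +-mono-≤ (n≢0⇒n>0 (λ ∣r-r′∣≡0 → r≢r′ (toℕ-injective (∣m-n∣≡0⇒m≡n ∣r-r′∣≡0)))) cols

module _ (m : ℕ) where

  private
    n : ℕ
    n = suc (m + m)

  place↔ : (Fin 3 × Fin n) ↔ (Fin 3 × Fin n)
  place↔ = shear↔ (λ t → rowShift (toℕ t)) (zigzag↔ m)

  label↔ : Fin (3 * n) ↔ (Fin 3 × Fin n)
  label↔ = place↔ ↔-∘ *↔×

  private
    row : Fin 3 → Fin n → Fin 3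
    row p t = Inverse.to (rowShift (toℕ t)) p

    column : Fin n → Fin n
    column = Inverse.to (zigzag↔ m)

    toℕ-column : ∀ t → toℕ (column t) ≡ zigzag m (toℕ t)
    toℕ-column t = toℕ-fromℕ< _

    block : Fin (3 * n) → Fin 3
    block = quotient {3} n

    position : Fin (3 * n) → Fin n
    position = remainder {3} n

  place-dispersed : ∀ p t p′ t′ → toℕ p′ * n + toℕ t′ ≡ suc (toℕ p * n + toℕ t) →
                    suc m ≤ manhattan (Inverse.to place↔ (p , t)) (Inverse.to place↔ (p′ , t′))
  place-dispersed p t p′ t′ eq with carry (toℕ<n t) (toℕ<n t′) eq
  ... | inj₁ (p′≡p , t′≡1+t) with refl ← toℕ-injective {i = p′} {p} p′≡p =
    apart⇒dispersed {c = column t} {column t′} rows cols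
    where
    rows : row p t ≢ row p t′
    rows rewrite t′≡1+t = rowShift-step (toℕ t) p
    cols : m ≤ ∣ toℕ (column t) - toℕ (column t′) ∣
    cols rewrite toℕ-column t | toℕ-column t′ | t′≡1+t = zigzag-step m (toℕ t)
  ... | inj₂ (p′≡1+p , t′≡0 , 1+t≡n) = apart⇒dispersed {c = column t} {column t′} rows cols
    where
    t≡2m : toℕ t ≡ m + m
    t≡2m = suc-injective 1+t≡n
    rows : row p t ≢ row p′ t′
    rows rewrite t≡2m | t′≡0 | rowShift-even m p =
      λ p≡p′ → 1+n≢n (sym (trans (cong toℕ p≡p′) p′≡1+p))
    cols : m ≤ ∣ toℕ (column t) - toℕ (column t′) ∣
    cols rewrite toℕ-column t | toℕ-column t′ | t≡2m | t′≡0 | zigzag-even m m =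
      ≤-reflexive (sym (∣-∣-identityʳ m))

  label-dispersed : ∀ i j → toℕ j ≡ suc (toℕ i) →
                    suc m ≤ manhattan (Inverse.to label↔ i) (Inverse.to label↔ j)
  label-dispersed i j j≡1+i = place-dispersed (block i) (position i) (block j) (position j) (begin
    toℕ (block j) * n + toℕ (position j)         ≡⟨ toℕ-remQuot {3} n j ⟨
    toℕ j                                        ≡⟨ j≡1+i ⟩
    suc (toℕ i)                                  ≡⟨ cong suc (toℕ-remQuot {3} n i) ⟩
    suc (toℕ (block i) * n + toℕ (position i))   ∎)
    where open ≡-Reasoning

  grid3×odd-DL : IsDL (L 3 n) (suc m)
  grid3×odd-DL = (↔⇒⤖ label↔ , dispersed) , λ _ → dispersion≤eccentricity grid-Adj-sym
    (λ u v → manhattan u v , grid-dist u v) 1<3n (proj₁ (centre-eccentricity {1} {m}))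
    where
    dispersed : ∀ i j → toℕ j ≡ suc (toℕ i) →
                ∀ d → Dist (L 3 n) (Inverse.to label↔ i) (Inverse.to label↔ j) d → suc m ≤ d
    dispersed i j j≡1+i d dist =
      subst (suc m ≤_) (sym (Dist⇒≡manhattan dist)) (label-dispersed i j j≡1+i)
    1<3n : 1 < 3 * n
    1<3n = s≤s (≤-trans (s≤s z≤n) (m≤n+m (2 * n) (m + m)))

m*2≡m+m : ∀ m → m * 2 ≡ m + m
m*2≡m+m m = trans (*-comm m 2) (cong (m +_) (+-identityʳ m))

odd≡1+2[n/2] : ∀ {n} → n % 2 ≡ 1 → n ≡ suc (n / 2 + n / 2)
odd≡1+2[n/2] {n} n%2≡1 = trans (m≡m%n+[m/n]*n n 2) (cong₂ _+_ n%2≡1 (m*2≡m+m (n / 2)))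

[1+2m+1]/2≡1+m : ∀ m → (suc (m + m) + 1) / 2 ≡ suc m
[1+2m+1]/2≡1+m m = trans (cong (_/ 2) (trans (+-comm _ 1) (cong (2 +_) (sym (m*2≡m+m m))))) (m*n/n≡m (suc m) 2)

-- The hypothesis 3 ≤ n is not needed: the case n = 1 holds as well.
theorem2p11 : (n : ℕ) → 3 ≤ n → n % 2 ≡ 1 →
    IsDL (L 3 n) ((n + 1) / 2) × IsRadius (L 3 n) ((n + 1) / 2)
theorem2p11 n _ n%2≡1 = subst Claim (sym (odd≡1+2[n/2] n%2≡1)) (claim (n / 2))
  where
  Claim : ℕ → Set
  Claim n = IsDL (L 3 n) ((n + 1) / 2) × IsRadius (L 3 n) ((n + 1) / 2)
  claim : ∀ m → Claim (suc (m + m))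
  claim m = subst (λ k → IsDL (L 3 (suc (m + m))) k × IsRadius (L 3 (suc (m + m))) k)
                  (sym ([1+2m+1]/2≡1+m m)) (grid3×odd-DL m , odd-grid-radius {1} {m})
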